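{- Let $r\ge 2$ and $n\ge 2r+1$. Let $\varphi$ be an automorphism of $H_{n:r}$ and let $x,y$ be vertices of $H_{n:r}$. If $x$ and $y$ have the same tail, then $\varphi(x)$ and $\varphi(y)$ have the same tail.
   Context: For positive integers $n,r$ write $[n]=\{1,\dots,n\}$. The Häggkvist–Hell graph $H_{n:r}$ is the graph whose vertices are the ordered pairs $(h,T)$ where $T$ is an $r$-element subset of $[n]$ and $h\in[n]\setminus T$ ($h$ is the head and $T$ the tail of the vertex); two vertices $(h_x,T_x)$ and $(h_y,T_y)$ are adjacent iff $h_x\in T_y$, $h_y\in T_x$ and $T_x\cap T_y=\varnothing$. -}

module Defs where

open import Data.Nat using (ℕ; _≡ᵇ_)
open import Data.Bool using (Bool; true; _∧_; not)
open import Data.Fin using (Fin)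
open import Data.Fin.Subset using (Subset; ∣_∣; _∈_; Empty; _∩_)
open import Data.Vec using (lookup)
open import Data.Product using (Σ; _×_)
open import Relation.Binary.PropositionalEquality using (_≡_)

-- Vertices of H_{n:r}: pairs (h , T) with T an r-subset of [n] = Fin n
-- and h ∉ T.  The side condition is a Bool equation so that equality of
-- vertices is equality of (head, tail).
validᵇ : {n : ℕ} → ℕ → Fin n → Subset n → Bool
validᵇ r h T = (∣ T ∣ ≡ᵇ r) ∧ not (lookup T h)

record Vertex (n r : ℕ) : Set where
  constructor vtx
  field
    head  : Fin n
    tail  : Subset n
    valid : validᵇ r head tail ≡ true

open Vertex public

Adj : {n r : ℕ} → Vertex n r → Vertex n r → Set
Adj x y = (head x ∈ tail y) × (head y ∈ tail x) × Empty (tail x ∩ tail y)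

IsAutomorphism : {n r : ℕ} → (Vertex n r → Vertex n r) → Set
IsAutomorphism {n} {r} φ =
  (Σ (Vertex n r → Vertex n r) λ ψ →
     ((x : Vertex n r) → ψ (φ x) ≡ x) × ((y : Vertex n r) → φ (ψ y) ≡ y))
  × ((x y : Vertex n r) → (Adj x y → Adj (φ x) (φ y)) × (Adj (φ x) (φ y) → Adj x y))

-- Idea: that relation is definable from adjacency alone.  Call x and y
-- *linked* if there is a path x ~ z, w ~ v ~ y such that z and w are joined
-- by no walk of length three.  We show
--   (1) vertices with the same tail are never linked: any would-be
--       configuration x ~ z, w ~ v ~ y admits a walk z ~ p ~ q ~ w, where
--       p keeps the common tail and q is a tail chosen in the complement;
--   (2) vertices with different tails are always linked: z and w can be
--       taken with the same head, and such vertices have no 3-walk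
--       (their heads would lie in the disjoint tails of the middle pair).
-- Being linked is phrased purely in terms of adjacency, so it is transported
-- along any automorphism, and the theorem follows by comparing (1) and (2).
module Submission where

open import Defs
open import Data.Nat using (ℕ; _≤_; _+_; _*_; zero; suc; z≤n; s≤s; _∸_; _≤?_)
open import Data.Nat.Properties as ℕ using (≤-trans; ≡ᵇ⇒≡; ≡⇒≡ᵇ)
open import Data.Bool using (true; false)
open import Data.Bool.Properties using (T-≡; T-∧; T-not-≡)
import Data.Bool as Bool
open import Data.Fin using (Fin)
open import Data.Fin.Subset
  using (Subset; ∣_∣; _∈_; _∉_; _⊆_; _∩_; _∪_; ∁; ⁅_⁆; Empty; inside; outside)
open import Data.Fin.Subset.Properties
open import Data.Vec using (_∷_; []; lookup; here)
open import Data.Vec.Properties using ([]=⇒lookup; lookup⇒[]=; ≡-dec)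
open import Data.Product using (Σ; ∃; ∃₂; _×_; _,_; proj₁; proj₂)
open import Data.Sum using (inj₁; inj₂; [_,_])
open import Data.Empty using (⊥-elim)
open import Relation.Nullary using (¬_; yes; no; contradiction)
open import Relation.Binary.PropositionalEquality
  using (_≡_; _≢_; refl; sym; trans; cong; cong₂; subst; subst₂)
open import Function.Bundles using (Equivalence)
open Equivalence using (to; from)

private
  variable
    n r : ℕ

valid⇒conditions : (h : Fin n) (T : Subset n) →
                   validᵇ r h T ≡ true → ∣ T ∣ ≡ r × h ∉ T
valid⇒conditions h T ok with to T-∧ (from T-≡ ok)
... | size , notIn =
  ≡ᵇ⇒≡ _ _ size , λ h∈T → contradiction (trans (sym ([]=⇒lookup h∈T)) (to T-not-≡ notIn)) λ ()

conditions⇒valid : (h : Fin n) (T : Subset n) →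
                   ∣ T ∣ ≡ r → h ∉ T → validᵇ r h T ≡ true
conditions⇒valid h T size h∉T =
  to T-≡ (from T-∧ (≡⇒≡ᵇ _ _ size , from T-not-≡ lookup-false))
  where
  lookup-false : lookup T h ≡ false
  lookup-false with lookup T h in e
  ... | false = refl
  ... | true  = contradiction (lookup⇒[]= h T e) h∉T

vertex : (h : Fin n) (T : Subset n) → ∣ T ∣ ≡ r → h ∉ T → Vertex n r
vertex h T size h∉T = vtx h T (conditions⇒valid h T size h∉T)

∣tail∣≡r : (x : Vertex n r) → ∣ tail x ∣ ≡ r
∣tail∣≡r x = proj₁ (valid⇒conditions (head x) (tail x) (valid x))

head∉tail : (x : Vertex n r) → head x ∉ tail x
head∉tail x = proj₂ (valid⇒conditions (head x) (tail x) (valid x))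

Disjoint : Subset n → Subset n → Set
Disjoint p q = ∀ {u} → u ∈ p → u ∉ q

disjoint⇒empty : {p q : Subset n} → Disjoint p q → Empty (p ∩ q)
disjoint⇒empty p#q (u , u∈p∩q) = let (u∈p , u∈q) = x∈p∩q⁻ _ _ u∈p∩q in p#q u∈p u∈q

empty⇒disjoint : {p q : Subset n} → Empty (p ∩ q) → Disjoint p q
empty⇒disjoint empty u∈p u∈q = empty (_ , x∈p∩q⁺ (u∈p , u∈q))

empty-sym : {p q : Subset n} → Empty (p ∩ q) → Empty (q ∩ p)
empty-sym empty = disjoint⇒empty λ u∈q u∈p → empty⇒disjoint empty u∈p u∈q

⊈⇒witness : (p q : Subset n) → ¬ (p ⊆ q) → ∃ λ d → d ∈ p × d ∉ q
⊈⇒witness p q p⊈q with nonempty? (p ∩ ∁ q)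
... | yes (d , d∈p∩∁q) =
  let (d∈p , d∈∁q) = x∈p∩q⁻ _ _ d∈p∩∁q in d , d∈p , x∈∁p⇒x∉p d∈∁q
... | no noWitness = ⊥-elim (p⊈q p⊆q)
  where
  p⊆q : p ⊆ q
  p⊆q {u} u∈p with u ∈? q
  ... | yes u∈q = u∈q
  ... | no  u∉q = ⊥-elim (noWitness (u , x∈p∩q⁺ (u∈p , x∉p⇒x∈∁p u∉q)))

⊆-∣≡∣⇒⊇ : {p q : Subset n} → p ⊆ q → ∣ p ∣ ≡ ∣ q ∣ → q ⊆ p
⊆-∣≡∣⇒⊇ {p = p} {q} p⊆q size {u} u∈q with u ∈? p
... | yes u∈p = u∈p
... | no  u∉p = contradiction size (ℕ.<⇒≢ (p⊂q⇒∣p∣<∣q∣ (p⊆q , u , u∈q , u∉p)))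

exchange : {U V : Subset n} {e : Fin n} → ∣ U ∣ ≡ ∣ V ∣ → e ∈ V → e ∉ U →
           ∃ λ d → d ∈ U × d ∉ V
exchange {U = U} {V} size e∈V e∉U =
  ⊈⇒witness U V λ U⊆V → e∉U (⊆-∣≡∣⇒⊇ U⊆V size e∈V)

≢⇒witness : {U V : Subset n} → ∣ U ∣ ≡ ∣ V ∣ → U ≢ V → ∃ λ d → d ∈ U × d ∉ V
≢⇒witness {U = U} {V} size U≢V =
  ⊈⇒witness U V λ U⊆V → U≢V (⊆-antisym U⊆V (⊆-∣≡∣⇒⊇ U⊆V size))

inhabited : (p : Subset n) → 1 ≤ ∣ p ∣ → ∃ λ e → e ∈ p
inhabited {n} p positive with nonempty? p
... | yes p≠∅ = p≠∅
... | no  p=∅ with Empty-unique p=∅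
...   | refl = contradiction (subst (1 ≤_) (∣⊥∣≡0 n) positive) λ ()

∣p∪q∣≤∣p∣+∣q∣ : (p q : Subset n) → ∣ p ∪ q ∣ ≤ ∣ p ∣ + ∣ q ∣
∣p∪q∣≤∣p∣+∣q∣ []            []            = z≤n
∣p∪q∣≤∣p∣+∣q∣ (outside ∷ p) (outside ∷ q) = ∣p∪q∣≤∣p∣+∣q∣ p q
∣p∪q∣≤∣p∣+∣q∣ (outside ∷ p) (inside  ∷ q) =
  subst (suc ∣ p ∪ q ∣ ≤_) (sym (ℕ.+-suc ∣ p ∣ ∣ q ∣)) (s≤s (∣p∪q∣≤∣p∣+∣q∣ p q))
∣p∪q∣≤∣p∣+∣q∣ (inside  ∷ p) (outside ∷ q) = s≤s (∣p∪q∣≤∣p∣+∣q∣ p q)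
∣p∪q∣≤∣p∣+∣q∣ (inside  ∷ p) (inside  ∷ q) =
  s≤s (≤-trans (∣p∪q∣≤∣p∣+∣q∣ p q) (ℕ.+-monoʳ-≤ ∣ p ∣ (ℕ.n≤1+n ∣ q ∣)))

intermediate : (k : ℕ) (A G : Subset n) → A ⊆ G → ∣ A ∣ ≤ k → k ≤ ∣ G ∣ →
               Σ (Subset n) λ Q → A ⊆ Q × Q ⊆ G × ∣ Q ∣ ≡ k
intermediate zero    []            []            _   _       _       = [] , (λ ()) , (λ ()) , refl
intermediate (suc k) []            []            _   _       ()
intermediate k       (inside ∷ A)  (outside ∷ G) A⊆G _       _       = contradiction (A⊆G here) λ ()
intermediate (suc k) (inside ∷ A)  (inside ∷ G)  A⊆G (s≤s a) (s≤s g)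
  with Q , A⊆Q , Q⊆G , size ← intermediate k A G (drop-∷-⊆ A⊆G) a g =
  inside ∷ Q , in⊆in A⊆Q , in⊆in Q⊆G , cong suc size
intermediate k       (outside ∷ A) (outside ∷ G) A⊆G a       g
  with Q , A⊆Q , Q⊆G , size ← intermediate k A G (drop-∷-⊆ A⊆G) a g =
  outside ∷ Q , out⊆ A⊆Q , out⊆ Q⊆G , size
intermediate k       (outside ∷ A) (inside ∷ G)  A⊆G a       g with k ≤? ∣ G ∣
... | yes k≤∣G∣
  with Q , A⊆Q , Q⊆G , size ← intermediate k A G (drop-∷-⊆ A⊆G) a k≤∣G∣ =
  outside ∷ Q , out⊆ A⊆Q , out⊆ Q⊆G , size
... | no k≰∣G∣
  with Q , A⊆Q , Q⊆G , size ← intermediate ∣ G ∣ A G (drop-∷-⊆ A⊆G) (p⊆q⇒∣p∣≤∣q∣ (drop-∷-⊆ A⊆G)) ℕ.≤-refl =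
  inside ∷ Q , out⊆ A⊆Q , in⊆in Q⊆G , trans (cong suc size) (ℕ.≤-antisym (ℕ.≰⇒> k≰∣G∣) g)

pair⊆∁ : {a b : Fin n} {X : Subset n} → a ∉ X → b ∉ X → ⁅ a ⁆ ∪ ⁅ b ⁆ ⊆ ∁ X
pair⊆∁ {a = a} {b} a∉X b∉X u∈pair with x∈p∪q⁻ ⁅ a ⁆ ⁅ b ⁆ u∈pair
... | inj₁ u∈⁅a⁆ rewrite x∈⁅y⁆⇒x≡y a u∈⁅a⁆ = x∉p⇒x∈∁p a∉X
... | inj₂ u∈⁅b⁆ rewrite x∈⁅y⁆⇒x≡y b u∈⁅b⁆ = x∉p⇒x∈∁p b∉X

∣pair∣≤2 : (a b : Fin n) → ∣ ⁅ a ⁆ ∪ ⁅ b ⁆ ∣ ≤ 2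
∣pair∣≤2 a b = subst (∣ ⁅ a ⁆ ∪ ⁅ b ⁆ ∣ ≤_) (cong₂ _+_ (∣⁅x⁆∣≡1 a) (∣⁅x⁆∣≡1 b))
                     (∣p∪q∣≤∣p∣+∣q∣ ⁅ a ⁆ ⁅ b ⁆)

record TailThrough (r : ℕ) (a b : Fin n) (X : Subset n) : Set where
  field
    set    : Subset n
    ∋a     : a ∈ set
    ∋b     : b ∈ set
    avoids : Disjoint set X
    size   : ∣ set ∣ ≡ r

chooseTail : {a b : Fin n} {X : Subset n} → 2 ≤ r → r ≤ ∣ ∁ X ∣ → a ∉ X → b ∉ X →
             TailThrough r a b X
chooseTail {a = a} {b} {X} 2≤r room a∉X b∉X
  with Q , pair⊆Q , Q⊆∁X , size ←
       intermediate _ (⁅ a ⁆ ∪ ⁅ b ⁆) (∁ X) (pair⊆∁ a∉X b∉X) (≤-trans (∣pair∣≤2 a b) 2≤r) room =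
  record { set    = Q
         ; ∋a     = pair⊆Q (x∈p∪q⁺ (inj₁ (x∈⁅x⁆ a)))
         ; ∋b     = pair⊆Q (x∈p∪q⁺ (inj₂ (x∈⁅x⁆ b)))
         ; avoids = λ u∈Q → x∈∁p⇒x∉p (Q⊆∁X u∈Q)
         ; size   = size
         }

room : 2 * r + 1 ≤ n → (X : Subset n) → ∣ X ∣ ≡ r → r ≤ ∣ ∁ X ∣
room {r} {n} n≥2r+1 X size =
  subst (r ≤_) (sym (trans (∣∁p∣≡n∸∣p∣ X) (cong (n ∸_) size))) (ℕ.m+n≤o⇒m≤o∸n r r+r≤n)
  where
  r+r≤n : r + r ≤ n
  r+r≤n = ≤-trans (ℕ.≤-reflexive (cong (r +_) (sym (ℕ.+-identityʳ r))))
                  (≤-trans (ℕ.m≤m+n (2 * r) 1) n≥2r+1)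

Walk3 : Vertex n r → Vertex n r → Set
Walk3 z w = ∃₂ λ p q → Adj z p × Adj p q × Adj q w

-- Vertices with a common head are joined by no walk z ~ p ~ q ~ w: the head
-- would lie both in tail p and in tail q, which are disjoint.
sameHead⇒noWalk3 : {z w : Vertex n r} → head z ≡ head w → ¬ Walk3 z w
sameHead⇒noWalk3 same (p , q , (hz∈p , _) , (_ , _ , p#q) , (_ , hw∈q , _)) =
  empty⇒disjoint p#q hz∈p (subst (_∈ tail q) (sym same) hw∈q)

record Linked (x y : Vertex n r) : Set where
  constructor linked
  field
    z w v : Vertex n r
    x~z   : Adj x z
    far   : ¬ Walk3 z w
    w~v   : Adj w v
    v~y   : Adj v y

-- Given x ~ z, w ~ v ~ y,
-- take d ∈ tail z ∖ tail w (it exists since head v ∈ tail w ∖ tail z) and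
-- p = (d , T), q = (head v , Q) with Q ∋ head w, d an r-set avoiding
-- tail w ∪ T (tail v shows there is room); then z ~ p ~ q ~ w.
sameTail⇒notLinked : 2 ≤ r → {x y : Vertex n r} → tail x ≡ tail y → ¬ Linked x y
sameTail⇒notLinked {r} {n} 2≤r {x} sameTail
  (linked z w v (_ , hz∈T , x#z) far (hw∈v , e∈w , w#v) (e∈y , _ , v#y)) =
  far (p , q , z~p , p~q , q~w)
  where
  T : Subset n
  T = tail x
  e : Fin n
  e = head v
  e∈T : e ∈ T
  e∈T = subst (e ∈_) (sym sameTail) e∈y
  witness : ∃ λ d → d ∈ tail z × d ∉ tail w
  witness = exchange (trans (∣tail∣≡r z) (sym (∣tail∣≡r w))) e∈w (empty⇒disjoint x#z e∈T)
  d : Fin n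
  d = proj₁ witness
  d∈z : d ∈ tail z
  d∈z = proj₁ (proj₂ witness)
  d∉T : d ∉ T
  d∉T d∈T = empty⇒disjoint x#z d∈T d∈z
  ∉w∪T : {u : Fin n} → u ∉ tail w → u ∉ T → u ∉ tail w ∪ T
  ∉w∪T u∉w u∉T u∈w∪T = [ u∉w , u∉T ] (x∈p∪q⁻ _ _ u∈w∪T)
  v#w∪T : Disjoint (tail v) (tail w ∪ T)
  v#w∪T u∈v = ∉w∪T (empty⇒disjoint (empty-sym w#v) u∈v)
                   (λ u∈T → empty⇒disjoint v#y u∈v (subst (_ ∈_) sameTail u∈T))
  roomQ : r ≤ ∣ ∁ (tail w ∪ T) ∣
  roomQ = subst (_≤ ∣ ∁ (tail w ∪ T) ∣) (∣tail∣≡r v)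
                (p⊆q⇒∣p∣≤∣q∣ λ u∈v → x∉p⇒x∈∁p (v#w∪T u∈v))
  Q : TailThrough r (head w) d (tail w ∪ T)
  Q = chooseTail 2≤r roomQ (v#w∪T hw∈v) (∉w∪T (proj₂ (proj₂ witness)) d∉T)
  open TailThrough Q
  p q : Vertex n r
  p = vertex d T (∣tail∣≡r x) d∉T
  q = vertex e set size λ e∈Q → avoids e∈Q (x∈p∪q⁺ (inj₂ e∈T))
  z~p : Adj z p
  z~p = hz∈T , d∈z , empty-sym x#z
  p~q : Adj p q
  p~q = ∋b , e∈T , disjoint⇒empty λ u∈T u∈Q → avoids u∈Q (x∈p∪q⁺ (inj₂ u∈T))
  q~w : Adj q w
  q~w = e∈w , ∋a , disjoint⇒empty λ u∈Q u∈w → avoids u∈Q (x∈p∪q⁺ (inj₁ u∈w))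

-- (2) Vertices x, y with different tails are linked: pick c ∈ tail x ∖ tail y
-- and e ∈ tail y, and take z = (c , U), w = (c , tail y), v = (e , S) with
-- U ∋ head x avoiding tail x and S ∋ head y, c avoiding tail y.  z and w
-- share their head, hence are joined by no 3-walk.
differentTails⇒linked : 2 ≤ r → 2 * r + 1 ≤ n → (x y : Vertex n r) →
                        tail x ≢ tail y → Linked x y
differentTails⇒linked {r} {n} 2≤r n≥2r+1 x y differ =
  linked z w v x~z (sameHead⇒noWalk3 {z = z} {w = w} refl) w~v v~y
  where
  witness : ∃ λ c → c ∈ tail x × c ∉ tail y
  witness = ≢⇒witness (trans (∣tail∣≡r x) (sym (∣tail∣≡r y))) differ
  c : Fin n
  c = proj₁ witness
  c∈x : c ∈ tail x
  c∈x = proj₁ (proj₂ witness)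
  c∉y : c ∉ tail y
  c∉y = proj₂ (proj₂ witness)
  member : ∃ λ e → e ∈ tail y
  member = inhabited (tail y) (subst (1 ≤_) (sym (∣tail∣≡r y)) (≤-trans (s≤s z≤n) 2≤r))
  e∈y : proj₁ member ∈ tail y
  e∈y = proj₂ member
  U : TailThrough r (head x) (head x) (tail x)
  U = chooseTail 2≤r (room n≥2r+1 (tail x) (∣tail∣≡r x)) (head∉tail x) (head∉tail x)
  S : TailThrough r (head y) c (tail y)
  S = chooseTail 2≤r (room n≥2r+1 (tail y) (∣tail∣≡r y)) (head∉tail y) c∉y
  module U = TailThrough U
  module S = TailThrough S
  z w v : Vertex n r
  z = vertex c U.set U.size λ c∈U → U.avoids c∈U c∈x
  w = vertex c (tail y) (∣tail∣≡r y) c∉y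
  v = vertex (proj₁ member) S.set S.size λ e∈S → S.avoids e∈S e∈y
  x~z : Adj x z
  x~z = U.∋a , c∈x , empty-sym (disjoint⇒empty U.avoids)
  w~v : Adj w v
  w~v = S.∋b , e∈y , empty-sym (disjoint⇒empty S.avoids)
  v~y : Adj v y
  v~y = e∈y , S.∋a , disjoint⇒empty S.avoids

PreservesAdj : (Vertex n r → Vertex n r) → Set
PreservesAdj {n} {r} σ = {a b : Vertex n r} → Adj a b → Adj (σ a) (σ b)

-- A map σ preserving adjacency and having an adjacency-preserving left
-- inverse τ preserves linkedness: a 3-walk σ z ~ ⋯ ~ σ w is carried by τ
-- to a 3-walk z ~ ⋯ ~ w.
linked-map : (σ τ : Vertex n r → Vertex n r) → PreservesAdj σ → PreservesAdj τ →
             ((a : Vertex n r) → τ (σ a) ≡ a) →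
             {x y : Vertex n r} → Linked x y → Linked (σ x) (σ y)
linked-map σ τ σ-adj τ-adj τσ (linked z w v x~z far w~v v~y) =
  linked (σ z) (σ w) (σ v) (σ-adj x~z) far′ (σ-adj w~v) (σ-adj v~y)
  where
  far′ : ¬ Walk3 (σ z) (σ w)
  far′ (p , q , σz~p , p~q , q~σw) =
    far (τ p , τ q , subst (λ t → Adj t (τ p)) (τσ z) (τ-adj σz~p) , τ-adj p~q ,
         subst (Adj (τ q)) (τσ w) (τ-adj q~σw))

automorphism-reflects-linked : (φ : Vertex n r → Vertex n r) → IsAutomorphism φ →
                               {x y : Vertex n r} → Linked (φ x) (φ y) → Linked x y
automorphism-reflects-linked φ ((ψ , ψφ , φψ) , adj) {x} {y} φx-φy =
  subst₂ Linked (ψφ x) (ψφ y) (linked-map ψ φ ψ-adj (proj₁ (adj _ _)) φψ φx-φy)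
  where
  ψ-adj : PreservesAdj ψ
  ψ-adj {a} {b} a~b = proj₂ (adj (ψ a) (ψ b)) (subst₂ Adj (sym (φψ a)) (sym (φψ b)) a~b)

mainTheorem20 : (n r : ℕ) → 2 ≤ r → 2 * r + 1 ≤ n →
    (φ : Vertex n r → Vertex n r) → IsAutomorphism φ →
    (x y : Vertex n r) → tail x ≡ tail y → tail (φ x) ≡ tail (φ y)
mainTheorem20 n r 2≤r n≥2r+1 φ aut x y sameTail
  with ≡-dec Bool._≟_ (tail (φ x)) (tail (φ y))
... | yes sameImage = sameImage
... | no  differ    =
  contradiction (automorphism-reflects-linked φ aut
                   (differentTails⇒linked 2≤r n≥2r+1 (φ x) (φ y) differ))
                (sameTail⇒notLinked 2≤r sameTail)
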